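{- Let $p>0$, let $Q=(q_1,\dots,q_J,e_0)\in M_p^+$ with $D(Q)\neq\emptyset$, let $Q^\infty=C_p^\infty(Q)=(q_1,q_2,\dots)$, let $D^\infty=(d_1,d_2,\dots)$ be the distance vector of $Q^\infty$, let $\alpha=\delta(Q)+1$ and $\gamma=\#\{i\ge1: d_i\le\alpha\}$. Then $D(Q)=(d_1,\dots,d_\gamma)$.
   Context: $M$ is the set of integer vectors $(v_1,\dots,v_{J+1})$ with $J\ge1$ odd, $v_i\ge1$ for $1\le i\le J$, $v_{J+1}\ge0$. Alternating parameters of $V\in M$: $\rho_0=0$, $\rho_{i+1}=\rho_i+v_{i+1}$ for $i$ even, $\rho_{i+1}=\rho_i-v_{i+1}$ for $i$ odd. $M_p^+$ is the set of $V\in M$ with an odd $t$, $1\le t\le J$, such that $\rho_i>0$ for $1\le i\le t$ and $\rho_t\ge p+1$ (for $p>0$ such $V$ have $v_1>1$). $\delta(V)=sum(V)-\#V$ (sum of coordinates minus number of coordinates). Distance vector of a finite $V=(v_1,\dots,v_{J+1})\in M$ with $v_1>1$: $\tau_V(0)=0$, $\tau_V(r)=(v_1-1)+\cdots+(v_r-1)$; $D(V)=\emptyset$ if $v_i>1$ for all $1\le i\le J$; otherwise $c_0=0$ and, while it exists, $c_{i+1}$ is the least $c$ with $c_i+1<c\le J$ and $v_c=1$; with $c_\gamma$ the last, $D(V)=(\tau_V(c_1),\dots,\tau_V(c_\gamma))$. Shift symmetric vector: $\lambda_0=p+1$; for $j\ge0$: if $j$ even, $s_{j+1}=\min\{q_{j+1},\lambda_j\}$,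 $\lambda_{j+1}=\lambda_j-s_{j+1}$; if $j$ odd, $s_{j+1}=\min\{q_{j+1},p+1-\lambda_j\}$, $\lambda_{j+1}=\lambda_j+s_{j+1}$; $e_{j+1}=q_{j+1}-s_{j+1}$ and $q_{J+j+1}=e_j+s_{j+1}$. $C_p^\infty(Q)=(q_1,q_2,\dots)$. Distance vector of $Q^\infty$: $\tau(0)=0$, $\tau(r)=(q_1-1)+\cdots+(q_r-1)$ for $r\ge1$; $c_0=0$ and for $i\ge0$, $c_{i+1}$ is the least index $c>c_i+1$ with $q_c=1$ (these exist under the hypotheses); $d_i=\tau(c_i)$ for $i\ge1$. -}

module Defs where

open import Data.Nat as ℕ using (ℕ; zero; suc; _+_; _∸_; _⊓_; _<_; _≤_; _≟_; _<?_)
open import Data.Integer as ℤ using (ℤ; +_)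
open import Data.Bool using (Bool; true; false; if_then_else_)
open import Data.List using (List; []; _∷_; _++_; [_]; map; length; filter)
open import Data.Vec using (Vec; toList)
open import Data.Product using (_×_; _,_; proj₁; proj₂; Σ; ∃)
open import Relation.Nullary using (yes; no; ¬_)
open import Relation.Binary.PropositionalEquality using (_≡_)

isEven : ℕ → Bool
isEven zero = true
isEven (suc n) = if isEven n then false else true

Odd : ℕ → Set
Odd n = isEven n ≡ false

-- 0-based list lookup with default 0
nth : List ℕ → ℕ → ℕ
nth [] _ = 0
nth (x ∷ xs) zero = x
nth (x ∷ xs) (suc n) = nth xs n

range1 : ℕ → List ℕ
range1 zero = []
range1 (suc n) = range1 n ++ [ suc n ]

sumℕ : List ℕ → ℕ
sumℕ [] = 0
sumℕ (x ∷ xs) = x + sumℕ xs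

-- A finite vector V = (v_1,...,v_J, v_{J+1}) is given as J, a Vec of
-- (v_1..v_J) and the last entry v_{J+1}.  Its 1-indexed coordinate function:

coord : {J : ℕ} → Vec ℕ J → ℕ → ℕ → ℕ
coord {J} vs last i with i ℕ.≤? J
... | yes _ = nth (toList vs) (i ∸ 1)
... | no _ = last

-- Membership in M: J ≥ 1 odd, v_i ≥ 1 for 1 ≤ i ≤ J (v_{J+1} ∈ ℕ automatic)
data AllPos : List ℕ → Set where
  [] : AllPos []
  _∷_ : ∀ {x xs} → 1 ≤ x → AllPos xs → AllPos (x ∷ xs)

InM : (J : ℕ) → Vec ℕ J → ℕ → Set
InM J vs last = (1 ≤ J) × Odd J × AllPos (toList vs)

rho : (ℕ → ℕ) → ℕ → ℤ
rho v zero = + 0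
rho v (suc i) = if isEven i then rho v i ℤ.+ + v (suc i) else rho v i ℤ.- + v (suc i)

InMpPlus : ℕ → (J : ℕ) → Vec ℕ J → ℕ → Set
InMpPlus p J vs last =
  InM J vs last ×
  Σ ℕ (λ t → Odd t × 1 ≤ t × t ≤ J ×
     (∀ i → 1 ≤ i → i ≤ t → ℤ.0ℤ ℤ.< rho (coord vs last) i) ×
     (+ (p + 1) ℤ.≤ rho (coord vs last) t))

delta : (J : ℕ) → Vec ℕ J → ℕ → ℤ
delta J vs last = + (sumℕ (toList vs) + last) ℤ.- + (J + 1)

tau : (ℕ → ℕ) → ℕ → ℤ
tau v zero = + 0
tau v (suc r) = tau v r ℤ.+ (+ v (suc r) ℤ.- + 1)

-- Greedy scan over increasing positions: with `last` = c_i, the next chosen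
-- position is the least c in the list with c_i + 1 < c and v_c = 1.
scanC : (ℕ → ℕ) → ℕ → List ℕ → List ℕ
scanC v lst [] = []
scanC v lst (c ∷ cs) with v c ≟ 1 | suc lst <? c
... | yes _ | yes _ = c ∷ scanC v c cs
... | _ | _ = scanC v lst cs

cIndices : {J : ℕ} → Vec ℕ J → ℕ → List ℕ
cIndices {J} vs last = scanC (coord vs last) 0 (range1 J)

distVec : {J : ℕ} → Vec ℕ J → ℕ → List ℤ
distVec vs last = map (tau (coord vs last)) (cIndices vs last)

-- state after j steps: (q_1, ..., q_{J+j}), λ_j, e_j
ShiftState : Set
ShiftState = List ℕ × ℕ × ℕ

shiftStep : ℕ → ℕ → ShiftState → ShiftState
shiftStep p j (l , lam , e) =
  let qj1 = nth l j
      s = if isEven j then qj1 ⊓ lam else qj1 ⊓ (p + 1 ∸ lam)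
      lam' = if isEven j then lam ∸ s else lam + s
  in (l ++ [ e + s ]) , lam' , (qj1 ∸ s)

shiftRun : ℕ → {J : ℕ} → Vec ℕ J → ℕ → ℕ → ShiftState
shiftRun p qs e0 zero = toList qs , p + 1 , e0
shiftRun p qs e0 (suc j) = shiftStep p j (shiftRun p qs e0 j)

-- q_n of C_p^∞(Q), 1-indexed (n ≥ 1)
qInf : ℕ → {J : ℕ} → Vec ℕ J → ℕ → ℕ → ℕ
qInf p qs e0 n = nth (proj₁ (shiftRun p qs e0 n)) (n ∸ 1)

IsDistIdx : (ℕ → ℕ) → (ℕ → ℕ) → Set
IsDistIdx q c =
  (c 0 ≡ 0) ×
  (∀ i → (suc (c i) < c (suc i)) × (q (c (suc i)) ≡ 1) ×
         (∀ m → suc (c i) < m → m < c (suc i) → ¬ (q m ≡ 1)))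

countLe : (ℕ → ℤ) → ℤ → ℕ → ℕ
countLe d α N = length (filter (λ i → d i ℤ.≤? α) (range1 N))

-- Every entry of Q^∞ is positive, and the shift construction keeps q_{j+1} + … + q_{J+j} + e_j = sum(Q)
-- (a sliding window). Hence τ(c) ≤ δ(Q) + 1 for every c ≤ J. A 1 at a position c = J + j + 1 beyond J
-- forces j ≥ 1 and e_j = 0, so τ(c) − (δ(Q) + 1) = (q_1 + … + q_j) − j, which is positive as q_1 ≥ 2.
-- The distances d_i ≤ α are therefore exactly those with c_i ≤ J, and since Q^∞ extends Q these are
-- the indices found by the greedy scan defining D(Q). The c_i exist because a 1 at position j + 1 ≥ 2
-- reappears at J + j + 1 or J + j + 2.
module Submission where

open import Defs
open import Data.Bool using (true; false; if_then_else_)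
open import Data.Bool.Properties using (if-float)
open import Data.Empty using (⊥-elim)
open import Data.Integer as ℤ using (ℤ; +_; +≤+; +<+)
import Data.Integer.Properties as ℤ
open import Data.Integer.Tactic.RingSolver using (solve-∀)
open import Data.List using (List; []; _∷_; _++_; [_]; map; length; filter)
open import Data.List.Properties using (length-++; map-∘; map-cong-local; filter-all)
open import Data.List.Relation.Unary.All using (All; []; _∷_)
open import Data.Nat
open import Data.Nat.Properties
open import Algebra.Properties.CommutativeSemigroup +-commutativeSemigroup using (xy∙z≈xz∙y)
import Data.Nat.Tactic.RingSolver as ℕ-Solver
open import Data.Product using (Σ; ∃; _×_; _,_; proj₁; proj₂)
open import Data.Sum using (_⊎_; inj₁; inj₂)
open import Data.Vec using (Vec; toList)
open import Data.Vec.Properties using (length-toList)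
open import Function using (_∘_)
open import Relation.Nullary using (¬_; yes; no)
open import Relation.Unary using (Decidable)
open import Relation.Binary.PropositionalEquality hiding ([_])

private
  x-y≡[x+z]-[y+z] : ∀ x y z → x ℤ.- y ≡ (x ℤ.+ z) ℤ.- (y ℤ.+ z)
  x-y≡[x+z]-[y+z] = solve-∀

  x-y≡[x+z]-[z+y] : ∀ x y z → x ℤ.- y ≡ (x ℤ.+ z) ℤ.- (z ℤ.+ y)
  x-y≡[x+z]-[z+y] = solve-∀

  [x-y]+y≡x : ∀ x y → (x ℤ.- y) ℤ.+ y ≡ x
  [x-y]+y≡x = solve-∀

[+a]-[+b]≤[+c]-[+d] : ∀ {a b c d} → a + d ≤ c + b → + a ℤ.- + b ℤ.≤ + c ℤ.- + d
[+a]-[+b]≤[+c]-[+d] {a} {b} {c} {d} h =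
  subst₂ ℤ._≤_ (sym (x-y≡[x+z]-[y+z] (+ a) (+ b) (+ d))) (sym (x-y≡[x+z]-[z+y] (+ c) (+ d) (+ b)))
    (ℤ.+-monoˡ-≤ (ℤ.- (+ b ℤ.+ + d)) (+≤+ h))

[+a]-[+b]<[+c]-[+d] : ∀ {a b c d} → a + d < c + b → + a ℤ.- + b ℤ.< + c ℤ.- + d
[+a]-[+b]<[+c]-[+d] {a} {b} {c} {d} h =
  subst₂ ℤ._<_ (sym (x-y≡[x+z]-[y+z] (+ a) (+ b) (+ d))) (sym (x-y≡[x+z]-[z+y] (+ c) (+ d) (+ b)))
    (ℤ.+-monoˡ-< (ℤ.- (+ b ℤ.+ + d)) (+<+ h))

0<[+a]-[+b]⇒b<a : ∀ {a b} → ℤ.0ℤ ℤ.< + a ℤ.- + b → b < a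
0<[+a]-[+b]⇒b<a {a} {b} h =
  ℤ.drop‿+<+ (subst (+ b ℤ.<_) ([x-y]+y≡x (+ a) (+ b)) (ℤ.+-monoˡ-< (+ b) h))

m∸[n∸o]≡m∸n+o : ∀ {m n o} → o ≤ n → n ≤ m → m ∸ (n ∸ o) ≡ m ∸ n + o
m∸[n∸o]≡m∸n+o {m} {n} {o} o≤n n≤m = begin
  m ∸ (n ∸ o)                      ≡⟨ cong (_∸ (n ∸ o)) split ⟨
  (m ∸ n + o) + (n ∸ o) ∸ (n ∸ o)  ≡⟨ m+n∸n≡m (m ∸ n + o) (n ∸ o) ⟩
  m ∸ n + o                        ∎
  where
  open ≡-Reasoning
  split : (m ∸ n + o) + (n ∸ o) ≡ m
  split = begin
    (m ∸ n + o) + (n ∸ o)  ≡⟨ +-assoc (m ∸ n) o (n ∸ o) ⟩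
    m ∸ n + (o + (n ∸ o))  ≡⟨ cong (_+_ (m ∸ n)) (m+[n∸m]≡n o≤n) ⟩
    m ∸ n + n              ≡⟨ m∸n+n≡m n≤m ⟩
    m                      ∎

0<m∸[m⊓n]⇒m⊓n≡n : ∀ {m n} → 0 < m ∸ (m ⊓ n) → m ⊓ n ≡ n
0<m∸[m⊓n]⇒m⊓n≡n {m} {n} 0<m∸m⊓n with ≤-total m n
... | inj₂ n≤m = m≥n⇒m⊓n≡n n≤m
... | inj₁ m≤n rewrite m≤n⇒m⊓n≡m m≤n | n∸n≡0 m = ⊥-elim (<-irrefl refl 0<m∸m⊓n)

partialSum : (ℕ → ℕ) → ℕ → ℕ
partialSum f zero = 0
partialSum f (suc r) = partialSum f r + f (suc r)

tau≡[+partialSum]-[+r] : ∀ f r → tau f r ≡ + partialSum f r ℤ.- + r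
tau≡[+partialSum]-[+r] f zero = refl
tau≡[+partialSum]-[+r] f (suc r) =
  trans (cong (ℤ._+ (+ f (suc r) ℤ.- + 1)) (tau≡[+partialSum]-[+r] f r))
        (rearrange (+ partialSum f r) (+ r) (+ f (suc r)))
  where
  rearrange : ∀ x y z → (x ℤ.- y) ℤ.+ (z ℤ.- + 1) ≡ (x ℤ.+ z) ℤ.- (+ 1 ℤ.+ y)
  rearrange = solve-∀

partialSum-cong : ∀ {f g} r → (∀ m → 1 ≤ m → m ≤ r → f m ≡ g m) → partialSum f r ≡ partialSum g r
partialSum-cong zero f≡g = refl
partialSum-cong (suc r) f≡g =
  cong₂ _+_ (partialSum-cong r (λ m 1≤m m≤r → f≡g m 1≤m (m≤n⇒m≤1+n m≤r))) (f≡g (suc r) (s≤s z≤n) ≤-refl)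

tau-cong : ∀ {f g} r → (∀ m → 1 ≤ m → m ≤ r → f m ≡ g m) → tau f r ≡ tau g r
tau-cong {f} {g} r f≡g = begin
  tau f r                        ≡⟨ tau≡[+partialSum]-[+r] f r ⟩
  + partialSum f r ℤ.- + r       ≡⟨ cong (λ x → + x ℤ.- + r) (partialSum-cong r f≡g) ⟩
  + partialSum g r ℤ.- + r       ≡⟨ tau≡[+partialSum]-[+r] g r ⟨
  tau g r                        ∎
  where open ≡-Reasoning

partialSum-suc : ∀ f n → partialSum f (suc n) ≡ f 1 + partialSum (f ∘ suc) n
partialSum-suc f zero = +-comm 0 (f 1)
partialSum-suc f (suc n) =
  trans (cong (_+ f (2 + n)) (partialSum-suc f n)) (+-assoc (f 1) (partialSum (f ∘ suc) n) (f (2 + n)))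

partialSum-nth : ∀ xs → partialSum (λ m → nth xs (m ∸ 1)) (length xs) ≡ sumℕ xs
partialSum-nth [] = refl
partialSum-nth (x ∷ xs) =
  trans (partialSum-suc (λ m → nth (x ∷ xs) (m ∸ 1)) (length xs))
        (cong (_+_ x) (trans (partialSum-cong (length xs) shift) (partialSum-nth xs)))
  where
  shift : ∀ m → 1 ≤ m → m ≤ length xs → nth (x ∷ xs) m ≡ nth xs (m ∸ 1)
  shift (suc m) _ _ = refl

partialSum-+ : ∀ {f} → (∀ m → 1 ≤ m → 1 ≤ f m) → ∀ c d → partialSum f c + d ≤ partialSum f (c + d)
partialSum-+ {f} f-pos c zero = ≤-reflexive (trans (+-identityʳ _) (cong (partialSum f) (sym (+-identityʳ c))))
partialSum-+ {f} f-pos c (suc d) = begin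
  partialSum f c + suc d              ≡⟨ +-suc (partialSum f c) d ⟩
  suc (partialSum f c + d)            ≡⟨ +-comm 1 _ ⟩
  partialSum f c + d + 1              ≤⟨ +-mono-≤ (partialSum-+ f-pos c d) (f-pos (suc (c + d)) (s≤s z≤n)) ⟩
  partialSum f (suc (c + d))          ≡⟨ cong (partialSum f) (+-suc c d) ⟨
  partialSum f (c + suc d)            ∎
  where open ≤-Reasoning

nth-++ˡ : ∀ xs ys {k} → k < length xs → nth (xs ++ ys) k ≡ nth xs k
nth-++ˡ (x ∷ xs) ys {zero} _ = refl
nth-++ˡ (x ∷ xs) ys {suc k} (s≤s k<n) = nth-++ˡ xs ys k<n

nth-length-∷ʳ : ∀ xs y → nth (xs ++ [ y ]) (length xs) ≡ y
nth-length-∷ʳ [] y = refl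
nth-length-∷ʳ (x ∷ xs) y = nth-length-∷ʳ xs y

AllPos-nth : ∀ {xs k} → AllPos xs → k < length xs → 1 ≤ nth xs k
AllPos-nth {k = zero} (1≤x ∷ _) _ = 1≤x
AllPos-nth {k = suc k} (_ ∷ xs-pos) (s≤s k<n) = AllPos-nth xs-pos k<n

countFrom : ℕ → ℕ → List ℕ
countFrom a zero = []
countFrom a (suc n) = a ∷ countFrom (suc a) n

countFrom-∷ʳ : ∀ a n → countFrom a (suc n) ≡ countFrom a n ++ [ a + n ]
countFrom-∷ʳ a zero = cong [_] (sym (+-identityʳ a))
countFrom-∷ʳ a (suc n) =
  cong (_∷_ a) (trans (countFrom-∷ʳ (suc a) n) (cong (λ x → countFrom (suc a) n ++ [ x ]) (sym (+-suc a n))))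

range1≡countFrom1 : ∀ n → range1 n ≡ countFrom 1 n
range1≡countFrom1 zero = refl
range1≡countFrom1 (suc n) = trans (cong (_++ [ suc n ]) (range1≡countFrom1 n)) (sym (countFrom-∷ʳ 1 n))

length-countFrom : ∀ a n → length (countFrom a n) ≡ n
length-countFrom a zero = refl
length-countFrom a (suc n) = cong suc (length-countFrom (suc a) n)

All-countFrom : ∀ {P : ℕ → Set} a n → (∀ m → a ≤ m → m < a + n → P m) → All P (countFrom a n)
All-countFrom a zero P-in = []
All-countFrom a (suc n) P-in =
  P-in a ≤-refl (m<m+n a (s≤s z≤n)) ∷
  All-countFrom (suc a) n (λ m a<m m<a+n → P-in m (<⇒≤ a<m) (subst (m <_) (sym (+-suc a n)) m<a+n))

countLe-all : ∀ d α k → (∀ i → 1 ≤ i → i ≤ k → d i ℤ.≤ α) → countLe d α k ≡ k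
countLe-all d α k all≤ = begin
  length (filter d≤α? (range1 k))       ≡⟨ cong (length ∘ filter d≤α?) (range1≡countFrom1 k) ⟩
  length (filter d≤α? (countFrom 1 k))  ≡⟨ cong length (filter-all d≤α? (All-countFrom 1 k (λ i 1≤i i<1+k → all≤ i 1≤i (≤-pred i<1+k)))) ⟩
  length (countFrom 1 k)                ≡⟨ length-countFrom 1 k ⟩
  k                                     ∎
  where
  open ≡-Reasoning
  d≤α? : Decidable (λ i → d i ℤ.≤ α)
  d≤α? i = d i ℤ.≤? α

least-from : ∀ {P : ℕ → Set} → Decidable P → ∀ d lo → P (d + lo) →
             Σ ℕ λ m → lo ≤ m × P m × (∀ k → lo ≤ k → k < m → ¬ P k)
least-from P? d lo Pd+lo with P? lo
... | yes Plo = lo , ≤-refl , Plo , λ k lo≤k k<lo _ → <⇒≱ k<lo lo≤k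
least-from P? zero lo Plo | no ¬Plo = ⊥-elim (¬Plo Plo)
least-from {P} P? (suc d) lo Pd+lo | no ¬Plo
  with least-from P? d (suc lo) (subst P (sym (+-suc d lo)) Pd+lo)
... | m , lo<m , Pm , below = m , <⇒≤ lo<m , Pm , below′
  where
  below′ : ∀ k → lo ≤ k → k < m → ¬ P k
  below′ k lo≤k k<m with m≤n⇒m<n∨m≡n lo≤k
  ... | inj₁ lo<k = below k lo<k k<m
  ... | inj₂ refl = ¬Plo

distIdx-exists : ∀ f → (∀ n → ∃ λ m → n < m × f m ≡ 1) → Σ (ℕ → ℕ) (IsDistIdx f)
distIdx-exists f unbounded = c , refl , λ i → proj₂ (next-spec (c i))
  where
  next-spec : ∀ n → Σ ℕ λ m → suc n < m × f m ≡ 1 × (∀ k → suc n < k → k < m → ¬ f k ≡ 1)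
  next-spec n with unbounded (suc n)
  ... | m , 1+n<m , fm≡1 =
    least-from (λ k → f k ≟ 1) (m ∸ suc (suc n)) (suc (suc n)) (subst (λ x → f x ≡ 1) (sym (m∸n+n≡m 1+n<m)) fm≡1)

  c : ℕ → ℕ
  c zero = 0
  c (suc i) = proj₁ (next-spec (c i))

scanC-cong : ∀ {v w} l {xs} → All (λ x → v x ≡ w x) xs → scanC v l xs ≡ scanC w l xs
scanC-cong l [] = refl
scanC-cong {v} {w} l {x ∷ xs} (vx≡wx ∷ v≡w) with v x ≟ 1 | w x ≟ 1 | suc l <? x
... | yes _   | yes _   | yes _ = cong (_∷_ x) (scanC-cong x v≡w)
... | yes _   | yes _   | no _  = scanC-cong l v≡w
... | no _    | no _    | _     = scanC-cong l v≡w
... | yes vx≡1 | no wx≢1 | _    = ⊥-elim (wx≢1 (trans (sym vx≡wx) vx≡1))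
... | no vx≢1 | yes wx≡1 | _    = ⊥-elim (vx≢1 (trans vx≡wx wx≡1))

scanC-nonempty : ∀ f l xs → ¬ scanC f l xs ≡ [] → ∃ λ m → f m ≡ 1 × suc l < m
scanC-nonempty f l [] ne = ⊥-elim (ne refl)
scanC-nonempty f l (x ∷ xs) ne with f x ≟ 1 | suc l <? x
... | yes fx≡1 | yes l+1<x = x , fx≡1 , l+1<x
... | yes _    | no _      = scanC-nonempty f l xs ne
... | no _     | _         = scanC-nonempty f l xs ne

module Greedy {f c : ℕ → ℕ} (greedy : IsDistIdx f c) where

  c-< : ∀ i → c i < c (suc i)
  c-< i = <⇒≤ (proj₁ (proj₂ greedy i))

  c-mono : ∀ {i j} → i ≤ j → c i ≤ c j
  c-mono {i} {j} i≤j with m≤n⇒m<n∨m≡n i≤j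
  ... | inj₂ refl = ≤-refl
  c-mono {i} {suc j} i≤j | inj₁ i<1+j = ≤-trans (c-mono (≤-pred i<1+j)) (<⇒≤ (c-< j))

  Gap : ℕ → ℕ → Set
  Gap i a = ∀ m → suc (c i) < m → m < a → ¬ f m ≡ 1

  gap⇒≤next : ∀ {i a} → Gap i a → a ≤ c (suc i)
  gap⇒≤next {i} {a} gap with proj₂ greedy i
  ... | ci+1<next , f-next≡1 , _ = ≮⇒≥ (λ next<a → gap (c (suc i)) ci+1<next next<a f-next≡1)

  gap⇒next≡ : ∀ {i a} → Gap i a → suc (c i) < a → f a ≡ 1 → c (suc i) ≡ a
  gap⇒next≡ {i} {a} gap ci+1<a fa≡1 with proj₂ greedy i
  ... | _ , _ , below-next =
    ≤-antisym (≮⇒≥ (λ a<next → below-next a ci+1<a a<next fa≡1)) (gap⇒≤next gap)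

  gap-extend : ∀ {i a} → Gap i a → (suc (c i) < a → ¬ f a ≡ 1) → Gap i (suc a)
  gap-extend gap a-not-next m ci+1<m m<a+1 with m≤n⇒m<n∨m≡n (≤-pred m<a+1)
  ... | inj₁ m<a = gap m ci+1<m m<a
  ... | inj₂ refl = a-not-next ci+1<m

  ScanResult : ℕ → List ℕ → ℕ → Set
  ScanResult i xs b = Σ ℕ λ k → scanC f (c i) xs ≡ map c (countFrom (suc i) k) × c (i + k) < b × b ≤ c (suc (i + k))

  scanC-greedy : ∀ n i a → c i < a → Gap i a → ScanResult i (countFrom a n) (a + n)
  scanC-skip : ∀ n i a → c i < a → Gap i (suc a) → ScanResult i (countFrom (suc a) n) (a + suc n)

  scanC-greedy zero i a ci<a gap =
    0 , refl , subst₂ (λ x y → c x < y) (sym (+-identityʳ i)) (sym (+-identityʳ a)) ci<a ,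
    subst₂ (λ x y → x ≤ c (suc y)) (sym (+-identityʳ a)) (sym (+-identityʳ i)) (gap⇒≤next gap)
  scanC-greedy (suc n) i a ci<a gap with f a ≟ 1 | suc (c i) <? a
  ... | yes fa≡1 | yes ci+1<a
    with next≡a ← gap⇒next≡ gap ci+1<a fa≡1
    with k , scan≡ , below , above ←
           scanC-greedy n (suc i) (suc a) (s≤s (≤-reflexive next≡a)) (λ m next+1<m m<a+1 _ →
             <⇒≱ next+1<m (m≤n⇒m≤1+n (subst (m ≤_) (sym next≡a) (≤-pred m<a+1))))
    = suc k ,
      cong₂ _∷_ (sym next≡a) (subst (λ x → scanC f x (countFrom (suc a) n) ≡ _) next≡a scan≡) ,
      subst₂ (λ x y → c x < y) (sym (+-suc i k)) (sym (+-suc a n)) below ,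
      subst₂ (λ x y → x ≤ c (suc y)) (sym (+-suc a n)) (sym (+-suc i k)) above
  ... | yes _ | no ¬ci+1<a = scanC-skip n i a ci<a (gap-extend gap (λ ci+1<a _ → ¬ci+1<a ci+1<a))
  ... | no fa≢1 | _ = scanC-skip n i a ci<a (gap-extend gap (λ _ → fa≢1))

  scanC-skip n i a ci<a gap
    with k , scan≡ , below , above ← scanC-greedy n i (suc a) (m≤n⇒m≤1+n ci<a) gap
    = k , scan≡ , subst (c (i + k) <_) (sym (+-suc a n)) below ,
      subst (_≤ c (suc (i + k))) (sym (+-suc a n)) above

  gap-at-start : Gap 0 1
  gap-at-start m 1+c0<m m<1 _ = <⇒≱ 1+c0<m (≤-trans (≤-pred m<1) z≤n)

  scanC-from-start : ∀ n → Σ ℕ λ k → scanC f 0 (countFrom 1 n) ≡ map c (countFrom 1 k) × c k < suc n × suc n ≤ c (suc k)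
  scanC-from-start n
    with k , scan≡ , below , above ← scanC-greedy n 0 1 (subst (_< 1) (sym (proj₁ greedy)) (s≤s z≤n)) gap-at-start
    = k , subst (λ x → scanC f x (countFrom 1 n) ≡ map c (countFrom 1 k)) (proj₁ greedy) scan≡ , below , above

isEven-cases : ∀ n → isEven n ≡ true ⊎ isEven n ≡ false
isEven-cases n with isEven n
... | true = inj₁ refl
... | false = inj₂ refl

module ShiftDynamics (p J : ℕ) (qs : Vec ℕ J) (e0 : ℕ) where

  q : ℕ → ℕ
  q = qInf p qs e0

  prefix : ℕ → List ℕ
  prefix j = proj₁ (shiftRun p qs e0 j)

  lam : ℕ → ℕ
  lam j = proj₁ (proj₂ (shiftRun p qs e0 j))

  e : ℕ → ℕ
  e j = proj₂ (proj₂ (shiftRun p qs e0 j))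

  -- Indices are shifted by one: cur j, s j are the paper's q_{j+1}, s_{j+1}, and room j is the bound
  -- λ_j (j even) or p + 1 − λ_j (j odd) that s_{j+1} is capped by.
  cur : ℕ → ℕ
  cur j = nth (prefix j) j

  room : ℕ → ℕ
  room j = if isEven j then lam j else p + 1 ∸ lam j

  s : ℕ → ℕ
  s j = cur j ⊓ room j

  step-s≡s : ∀ j → (if isEven j then cur j ⊓ lam j else cur j ⊓ (p + 1 ∸ lam j)) ≡ s j
  step-s≡s j = sym (if-float (_⊓_ (cur j)) (isEven j))

  prefix-suc : ∀ j → prefix (suc j) ≡ prefix j ++ [ e j + s j ]
  prefix-suc j = cong (λ x → prefix j ++ [ e j + x ]) (step-s≡s j)

  e-suc : ∀ j → e (suc j) ≡ cur j ∸ s j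
  e-suc j = cong (cur j ∸_) (step-s≡s j)

  room-even : ∀ j → isEven j ≡ true → room j ≡ lam j
  room-even j even-j rewrite even-j = refl

  room-odd : ∀ j → isEven j ≡ false → room j ≡ p + 1 ∸ lam j
  room-odd j odd-j rewrite odd-j = refl

  room-suc-even : ∀ j → isEven j ≡ true → room (suc j) ≡ p + 1 ∸ lam (suc j)
  room-suc-even j even-j rewrite even-j = refl

  room-suc-odd : ∀ j → isEven j ≡ false → room (suc j) ≡ lam (suc j)
  room-suc-odd j odd-j rewrite odd-j = refl

  lam-suc-even : ∀ j → isEven j ≡ true → lam (suc j) ≡ lam j ∸ s j
  lam-suc-even j even-j rewrite even-j = refl

  lam-suc-odd : ∀ j → isEven j ≡ false → lam (suc j) ≡ lam j + s j
  lam-suc-odd j odd-j rewrite odd-j = refl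

  room≤p+1 : ∀ j → lam j ≤ p + 1 → room j ≤ p + 1
  room≤p+1 j lam≤p+1 with isEven-cases j
  ... | inj₁ parity = subst (_≤ p + 1) (sym (room-even j parity)) lam≤p+1
  ... | inj₂ parity = subst (_≤ p + 1) (sym (room-odd j parity)) (m∸n≤m (p + 1) (lam j))

  lam-suc-≤ : ∀ j → lam j ≤ p + 1 → s j ≤ room j → lam (suc j) ≤ p + 1
  lam-suc-≤ j lam≤p+1 s≤room with isEven-cases j
  ... | inj₁ parity = subst (_≤ p + 1) (sym (lam-suc-even j parity)) (≤-trans (m∸n≤m (lam j) (s j)) lam≤p+1)
  ... | inj₂ parity = begin
    lam (suc j)             ≡⟨ lam-suc-odd j parity ⟩
    lam j + s j             ≤⟨ +-monoʳ-≤ (lam j) (subst (s j ≤_) (room-odd j parity) s≤room) ⟩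
    lam j + (p + 1 ∸ lam j) ≡⟨ m+[n∸m]≡n lam≤p+1 ⟩
    p + 1                   ∎
    where open ≤-Reasoning

  -- The two bounds λ and p + 1 − λ swap roles at every step, so the parity drops out of this recurrence.
  room-suc : ∀ j → lam j ≤ p + 1 → s j ≤ room j → room (suc j) ≡ (p + 1 ∸ room j) + s j
  room-suc j lam≤p+1 s≤room with isEven-cases j
  ... | inj₁ parity = begin
    room (suc j)                ≡⟨ room-suc-even j parity ⟩
    p + 1 ∸ lam (suc j)         ≡⟨ cong (p + 1 ∸_) (lam-suc-even j parity) ⟩
    p + 1 ∸ (lam j ∸ s j)       ≡⟨ m∸[n∸o]≡m∸n+o (subst (s j ≤_) (room-even j parity) s≤room) lam≤p+1 ⟩
    (p + 1 ∸ lam j) + s j       ≡⟨ cong (λ r → (p + 1 ∸ r) + s j) (room-even j parity) ⟨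
    (p + 1 ∸ room j) + s j      ∎
    where open ≡-Reasoning
  ... | inj₂ parity = begin
    room (suc j)                    ≡⟨ room-suc-odd j parity ⟩
    lam (suc j)                     ≡⟨ lam-suc-odd j parity ⟩
    lam j + s j                     ≡⟨ cong (_+ s j) (m∸[m∸n]≡n lam≤p+1) ⟨
    (p + 1 ∸ (p + 1 ∸ lam j)) + s j ≡⟨ cong (λ r → (p + 1 ∸ r) + s j) (room-odd j parity) ⟨
    (p + 1 ∸ room j) + s j          ∎
    where open ≡-Reasoning

  length-prefix : ∀ j → length (prefix j) ≡ J + j
  length-prefix zero = trans (length-toList qs) (sym (+-identityʳ J))
  length-prefix (suc j) = begin
    length (prefix (suc j))        ≡⟨ cong length (prefix-suc j) ⟩
    length (prefix j ++ [ _ ])     ≡⟨ length-++ (prefix j) ⟩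
    length (prefix j) + 1          ≡⟨ cong (_+ 1) (length-prefix j) ⟩
    J + j + 1                      ≡⟨ +-assoc J j 1 ⟩
    J + (j + 1)                    ≡⟨ cong (_+_ J) (+-comm j 1) ⟩
    J + suc j                      ∎
    where open ≡-Reasoning

  prefix-stable : ∀ j d {k} → k < J + j → nth (prefix (d + j)) k ≡ nth (prefix j) k
  prefix-stable j zero k<J+j = refl
  prefix-stable j (suc d) {k} k<J+j = begin
    nth (prefix (suc (d + j))) k           ≡⟨ cong (λ xs → nth xs k) (prefix-suc (d + j)) ⟩
    nth (prefix (d + j) ++ [ _ ]) k        ≡⟨ nth-++ˡ (prefix (d + j)) _ k<length ⟩
    nth (prefix (d + j)) k                 ≡⟨ prefix-stable j d k<J+j ⟩
    nth (prefix j) k                       ∎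
    where
    open ≡-Reasoning
    k<length : k < length (prefix (d + j))
    k<length = subst (k <_) (sym (length-prefix (d + j))) (<-≤-trans k<J+j (+-monoʳ-≤ J (m≤n+m j d)))

  q≡nth-prefix : ∀ j {k} → k < J + j → q (suc k) ≡ nth (prefix j) k
  q≡nth-prefix j {k} k<J+j with ≤-total (suc k) j
  ... | inj₁ k<j = sym (trans (cong (λ i → nth (prefix i) k) (sym (m∸n+n≡m k<j)))
                              (prefix-stable (suc k) (j ∸ suc k) (m≤n+m (suc k) J)))
  ... | inj₂ j≤k = trans (cong (λ i → nth (prefix i) k) (sym (m∸n+n≡m j≤k)))
                         (prefix-stable j (suc k ∸ j) k<J+j)

  q-new : ∀ j → q (suc (J + j)) ≡ e j + s j
  q-new j = begin
    q (suc (J + j))                        ≡⟨ q≡nth-prefix (suc j) (subst (J + j <_) (sym (+-suc J j)) ≤-refl) ⟩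
    nth (prefix (suc j)) (J + j)           ≡⟨ cong₂ nth (prefix-suc j) (sym (length-prefix j)) ⟩
    nth (prefix j ++ [ e j + s j ]) (length (prefix j)) ≡⟨ nth-length-∷ʳ (prefix j) (e j + s j) ⟩
    e j + s j                              ∎
    where open ≡-Reasoning

  q≡initial : ∀ {m} → 1 ≤ m → m ≤ J → q m ≡ nth (toList qs) (m ∸ 1)
  q≡initial {suc k} _ m≤J = q≡nth-prefix 0 (subst (k <_) (sym (+-identityʳ J)) m≤J)

  coord≡q : ∀ {m} → 1 ≤ m → m ≤ J → coord qs e0 m ≡ q m
  coord≡q {m} 1≤m m≤J with m ≤? J
  ... | yes _ = sym (q≡initial 1≤m m≤J)
  ... | no m≰J = ⊥-elim (m≰J m≤J)

  partialSum-q-J : partialSum q J ≡ sumℕ (toList qs)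
  partialSum-q-J = begin
    partialSum q J                                                    ≡⟨ partialSum-cong J (λ m 1≤m m≤J → q≡initial 1≤m m≤J) ⟩
    partialSum (λ m → nth (toList qs) (m ∸ 1)) J                      ≡⟨ cong (partialSum _) (length-toList qs) ⟨
    partialSum (λ m → nth (toList qs) (m ∸ 1)) (length (toList qs))   ≡⟨ partialSum-nth (toList qs) ⟩
    sumℕ (toList qs)                                                  ∎
    where open ≡-Reasoning

  module WellFormed (1≤J : 1 ≤ J) (qs-pos : AllPos (toList qs)) where

    cur≡q : ∀ j → cur j ≡ q (suc j)
    cur≡q j = sym (q≡nth-prefix j (m<n+m j 1≤J))

    -- Proved together: s_{j+1} ≥ 1 needs q_{j+1} ≥ 1, and the new entry q_{J+j+1} is at least s_{j+1}.
    Invariant : ℕ → Set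
    Invariant j = lam j ≤ p + 1 × 1 ≤ room j × (∀ m → 1 ≤ m → m ≤ J + j → 1 ≤ q m)

    invariant : ∀ j → Invariant j
    invariant zero = ≤-refl , m≤n+m 1 p , initial-pos
      where
      initial-pos : ∀ m → 1 ≤ m → m ≤ J + 0 → 1 ≤ q m
      initial-pos (suc k) 1≤m m≤J+0 =
        subst (1 ≤_) (sym (q≡initial 1≤m m≤J))
          (AllPos-nth qs-pos (subst (k <_) (sym (length-toList qs)) m≤J))
        where
        m≤J : suc k ≤ J
        m≤J = subst (suc k ≤_) (+-identityʳ J) m≤J+0
    invariant (suc j) with lam≤p+1 , 1≤room , q-pos ← invariant j =
      lam-suc-≤ j lam≤p+1 s≤room ,
      subst (1 ≤_) (sym (room-suc j lam≤p+1 s≤room)) (≤-trans 1≤s (m≤n+m (s j) _)) ,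
      q-pos′
      where
      1≤s : 1 ≤ s j
      1≤s = ⊓-glb (subst (1 ≤_) (sym (cur≡q j)) (q-pos (suc j) (s≤s z≤n) (+-monoˡ-≤ j 1≤J))) 1≤room
      s≤room : s j ≤ room j
      s≤room = m⊓n≤n (cur j) (room j)
      q-pos′ : ∀ m → 1 ≤ m → m ≤ J + suc j → 1 ≤ q m
      q-pos′ m 1≤m m≤J+j+1 with m≤n⇒m<n∨m≡n (subst (m ≤_) (+-suc J j) m≤J+j+1)
      ... | inj₁ m<J+j+1 = q-pos m 1≤m (≤-pred m<J+j+1)
      ... | inj₂ refl = subst (1 ≤_) (sym (q-new j)) (≤-trans 1≤s (m≤n+m (s j) (e j)))

    q-pos : ∀ m → 1 ≤ m → 1 ≤ q m
    q-pos m 1≤m = proj₂ (proj₂ (invariant m)) m 1≤m (m≤n+m m J)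

    s-pos : ∀ j → 1 ≤ s j
    s-pos j = ⊓-glb (subst (1 ≤_) (sym (cur≡q j)) (q-pos (suc j) (s≤s z≤n))) (proj₁ (proj₂ (invariant j)))

    S : ℕ
    S = sumℕ (toList qs) + e0

    -- The step is q_{J+j+1} + e_{j+1} = e_j + q_{j+1}.
    window : ∀ j → partialSum q (J + j) + e j ≡ partialSum q j + S
    window zero = trans (cong (λ r → partialSum q r + e0) (+-identityʳ J)) (cong (_+ e0) partialSum-q-J)
    window (suc j) = begin
      partialSum q (J + suc j) + e (suc j)                 ≡⟨ cong₂ (λ r x → partialSum q r + x) (+-suc J j) (e-suc j) ⟩
      partialSum q (J + j) + q (suc (J + j)) + (cur j ∸ s j) ≡⟨ cong (λ x → partialSum q (J + j) + x + (cur j ∸ s j)) (q-new j) ⟩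
      partialSum q (J + j) + (e j + s j) + (cur j ∸ s j)   ≡⟨ regroup (partialSum q (J + j)) (e j) (s j) (cur j ∸ s j) ⟩
      (partialSum q (J + j) + e j) + (s j + (cur j ∸ s j)) ≡⟨ cong₂ _+_ (window j) (m+[n∸m]≡n (m⊓n≤m (cur j) (room j))) ⟩
      partialSum q j + S + cur j                           ≡⟨ cong (_+_ (partialSum q j + S)) (cur≡q j) ⟩
      partialSum q j + S + q (suc j)                       ≡⟨ xy∙z≈xz∙y (partialSum q j) S (q (suc j)) ⟩
      partialSum q (suc j) + S                             ∎
      where
      open ≡-Reasoning
      regroup : ∀ a b c d → a + (b + c) + d ≡ (a + b) + (c + d)
      regroup = ℕ-Solver.solve-∀

    -- A positive excess means the previous step was capped by its room, which fills the room back to p + 1.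
    wall : ∀ i → 1 ≤ e (suc i) → room (suc i) ≡ p + 1
    wall i 1≤e = begin
      room (suc i)                  ≡⟨ room-suc i lam≤p+1 (m⊓n≤n (cur i) (room i)) ⟩
      (p + 1 ∸ room i) + s i        ≡⟨ cong (_+_ (p + 1 ∸ room i)) s≡room ⟩
      (p + 1 ∸ room i) + room i     ≡⟨ m∸n+n≡m (room≤p+1 i lam≤p+1) ⟩
      p + 1                         ∎
      where
      open ≡-Reasoning
      lam≤p+1 : lam i ≤ p + 1
      lam≤p+1 = proj₁ (invariant i)
      s≡room : s i ≡ room i
      s≡room = 0<m∸[m⊓n]⇒m⊓n≡n (subst (1 ≤_) (e-suc i) 1≤e)

    s≡1 : ∀ j → q (suc j) ≡ 1 → s j ≡ 1
    s≡1 j q≡1 = ≤-antisym (subst (s j ≤_) (trans (cur≡q j) q≡1) (m⊓n≤m (cur j) (room j))) (s-pos j)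

    -- If e_{i+1} > 0 then step i hit its wall, so after moving this 1 the room is exactly 1.
    one-propagates : ∀ i → q (2 + i) ≡ 1 → q (suc (J + suc i)) ≡ 1 ⊎ q (suc (J + suc (suc i))) ≡ 1
    one-propagates i q≡1 with e (suc i) ≟ 0
    ... | yes e≡0 = inj₁ (trans (q-new (suc i)) (cong₂ _+_ e≡0 (s≡1 (suc i) q≡1)))
    ... | no e≢0 = inj₂ (trans (q-new (suc (suc i))) (cong₂ _+_ e′≡0 s′≡1))
      where
      room′≡1 : room (2 + i) ≡ 1
      room′≡1 = begin
        room (2 + i)                         ≡⟨ room-suc (suc i) (proj₁ (invariant (suc i))) (m⊓n≤n _ _) ⟩
        (p + 1 ∸ room (suc i)) + s (suc i)   ≡⟨ cong₂ (λ r x → (p + 1 ∸ r) + x) (wall i (n≢0⇒n>0 e≢0)) (s≡1 (suc i) q≡1) ⟩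
        (p + 1 ∸ (p + 1)) + 1                ≡⟨ cong (_+ 1) (n∸n≡0 (p + 1)) ⟩
        1                                    ∎
        where open ≡-Reasoning
      e′≡0 : e (2 + i) ≡ 0
      e′≡0 = trans (e-suc (suc i)) (cong₂ _∸_ (trans (cur≡q (suc i)) q≡1) (s≡1 (suc i) q≡1))
      s′≡1 : s (2 + i) ≡ 1
      s′≡1 = trans (cong (_⊓_ (cur (2 + i))) room′≡1)
                   (m≥n⇒m⊓n≡n (subst (1 ≤_) (sym (cur≡q (2 + i))) (q-pos (3 + i) (s≤s z≤n))))

    later-one : ∀ {m} → 2 ≤ m → q m ≡ 1 → ∃ λ m′ → m < m′ × q m′ ≡ 1
    later-one {suc (suc i)} (s≤s (s≤s _)) q≡1 with one-propagates i q≡1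
    ... | inj₁ q≡1′ = suc (J + suc i) , s≤s (+-monoˡ-≤ (suc i) 1≤J) , q≡1′
    ... | inj₂ q≡1′ = suc (J + suc (suc i)) , s≤s (+-mono-≤ 1≤J (n≤1+n (suc i))) , q≡1′

    ones-unbounded : ∀ {m₀} → 2 ≤ m₀ → q m₀ ≡ 1 → ∀ n → ∃ λ m → n < m × q m ≡ 1
    ones-unbounded {m₀} 2≤m₀ q≡1 n = let m , n<m , _ , qm≡1 = beyond n in m , n<m , qm≡1
      where
      beyond : ∀ n → ∃ λ m → n < m × 2 ≤ m × q m ≡ 1
      beyond zero = m₀ , <-≤-trans (s≤s z≤n) 2≤m₀ , 2≤m₀ , q≡1
      beyond (suc n) with m , n<m , 2≤m , qm≡1 ← beyond n with m′ , m<m′ , qm′≡1 ← later-one 2≤m qm≡1 =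
        m′ , ≤-trans (s≤s n<m) m<m′ , ≤-trans 2≤m (<⇒≤ m<m′) , qm′≡1

    q₁≥2 : 1 ≤ p → ∀ t → 1 ≤ t → t ≤ J → (∀ i → 1 ≤ i → i ≤ t → ℤ.0ℤ ℤ.< rho (coord qs e0) i) →
           + (p + 1) ℤ.≤ rho (coord qs e0) t → 2 ≤ q 1
    q₁≥2 1≤p (suc zero) _ _ _ ρ₁≥p+1 =
      subst (2 ≤_) (coord≡q (s≤s z≤n) 1≤J) (≤-trans (+-monoˡ-≤ 1 1≤p) (ℤ.drop‿+≤+ ρ₁≥p+1))
    q₁≥2 1≤p (suc (suc t)) _ t≤J ρ-pos _ =
      subst (2 ≤_) (coord≡q (s≤s z≤n) 1≤J) (≤-<-trans 1≤v₂ (0<[+a]-[+b]⇒b<a (ρ-pos 2 (s≤s z≤n) (s≤s (s≤s z≤n)))))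
      where
      2≤J : 2 ≤ J
      2≤J = ≤-trans (s≤s (s≤s z≤n)) t≤J
      1≤v₂ : 1 ≤ coord qs e0 2
      1≤v₂ = subst (1 ≤_) (sym (coord≡q (s≤s z≤n) 2≤J)) (q-pos 2 (s≤s z≤n))

    α : ℤ
    α = delta J qs e0 ℤ.+ + 1

    α≡[+S+1]-[+J+1] : α ≡ + (S + 1) ℤ.- + (J + 1)
    α≡[+S+1]-[+J+1] = [x-y]+1≡[x+1]-y (+ S) (+ (J + 1))
      where
      [x-y]+1≡[x+1]-y : ∀ x y → (x ℤ.- y) ℤ.+ + 1 ≡ (x ℤ.+ + 1) ℤ.- y
      [x-y]+1≡[x+1]-y = solve-∀

    tau≤α : ∀ m → m ≤ J → tau q m ℤ.≤ α
    tau≤α m m≤J =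
      subst₂ ℤ._≤_ (sym (tau≡[+partialSum]-[+r] q m)) (sym α≡[+S+1]-[+J+1])
        ([+a]-[+b]≤[+c]-[+d] {partialSum q m} {m} {S + 1} {J + 1} bound)
      where
      J+1≡ : J + 1 ≡ (J ∸ m) + (1 + m)
      J+1≡ = trans (+-comm J 1) (sym (trans (+-suc (J ∸ m) m) (cong suc (m∸n+n≡m m≤J))))
      bound : partialSum q m + (J + 1) ≤ (S + 1) + m
      bound = begin
        partialSum q m + (J + 1)              ≡⟨ cong (_+_ (partialSum q m)) J+1≡ ⟩
        partialSum q m + ((J ∸ m) + (1 + m))  ≡⟨ +-assoc (partialSum q m) (J ∸ m) (1 + m) ⟨
        partialSum q m + (J ∸ m) + (1 + m)    ≤⟨ +-monoˡ-≤ (1 + m) (partialSum-+ q-pos m (J ∸ m)) ⟩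
        partialSum q (m + (J ∸ m)) + (1 + m)  ≡⟨ cong (λ r → partialSum q r + (1 + m)) (m+[n∸m]≡n m≤J) ⟩
        partialSum q J + (1 + m)              ≤⟨ +-monoˡ-≤ (1 + m) (subst (_≤ S) (sym partialSum-q-J) (m≤m+n _ e0)) ⟩
        S + (1 + m)                           ≡⟨ +-assoc S 1 m ⟨
        S + 1 + m                             ∎
        where open ≤-Reasoning

    α<tau[1+J+j] : 1 ≤ p → 2 ≤ q 1 → ∀ j → q (suc (J + j)) ≡ 1 → α ℤ.< tau q (suc (J + j))
    α<tau[1+J+j] 1≤p 2≤q₁ zero q≡1 = ⊥-elim (<-irrefl refl (subst (2 ≤_) q≡1 2≤q))
      where
      2≤q : 2 ≤ q (suc (J + 0))
      2≤q = subst (2 ≤_) (sym (q-new 0))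
              (≤-trans (⊓-glb (subst (2 ≤_) (sym (cur≡q 0)) 2≤q₁) (+-monoˡ-≤ 1 1≤p)) (m≤n+m (s 0) e0))
    α<tau[1+J+j] 1≤p 2≤q₁ (suc j) q≡1 =
      subst₂ ℤ._<_ (sym α≡[+S+1]-[+J+1]) (sym (tau≡[+partialSum]-[+r] q n))
        ([+a]-[+b]<[+c]-[+d] {S + 1} {J + 1} {partialSum q n} {n} bound)
      where
      n : ℕ
      n = suc (J + suc j)
      P : ℕ
      P = partialSum q (suc j)
      e≡0 : e (suc j) ≡ 0
      e≡0 = n≤0⇒n≡0 (+-cancelʳ-≤ 1 (e (suc j)) 0
              (subst (e (suc j) + 1 ≤_) (trans (sym (q-new (suc j))) q≡1) (+-monoʳ-≤ (e (suc j)) (s-pos (suc j)))))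
      partialSum-n : partialSum q n ≡ P + S + 1
      partialSum-n = cong₂ _+_ (trans (sym (+-identityʳ _)) (trans (cong (_+_ _) (sym e≡0)) (window (suc j)))) q≡1
      2+j≤P : 2 + j ≤ P
      2+j≤P = subst (2 + j ≤_) (sym (partialSum-suc q j)) (+-mono-≤ 2≤q₁ (partialSum-+ (λ m _ → q-pos (suc m) (s≤s z≤n)) 0 j))
      bound : (S + 1) + n < partialSum q n + (J + 1)
      bound = begin-strict
        (S + 1) + n              ≡⟨ lhs S J j ⟩
        (1 + j) + (S + J + 2)    <⟨ +-monoˡ-< (S + J + 2) 2+j≤P ⟩
        P + (S + J + 2)          ≡⟨ rhs P S J ⟨
        (P + S + 1) + (J + 1)    ≡⟨ cong (_+ (J + 1)) partialSum-n ⟨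
        partialSum q n + (J + 1) ∎
        where
        open ≤-Reasoning
        lhs : ∀ S J j → (S + 1) + suc (J + suc j) ≡ (1 + j) + (S + J + 2)
        lhs = ℕ-Solver.solve-∀
        rhs : ∀ P S J → (P + S + 1) + (J + 1) ≡ P + (S + J + 2)
        rhs = ℕ-Solver.solve-∀

    α<tau : 1 ≤ p → 2 ≤ q 1 → ∀ {m} → J < m → q m ≡ 1 → α ℤ.< tau q m
    α<tau 1≤p 2≤q₁ {m} J<m q≡1 =
      subst (λ x → α ℤ.< tau q x) m≡ (α<tau[1+J+j] 1≤p 2≤q₁ (m ∸ suc J) (subst (λ x → q x ≡ 1) (sym m≡) q≡1))
      where
      m≡ : suc (J + (m ∸ suc J)) ≡ m
      m≡ = trans (cong suc (+-comm J (m ∸ suc J))) (trans (sym (+-suc (m ∸ suc J) J)) (m∸n+n≡m J<m))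

    coord≡q-prefix : All (λ m → coord qs e0 m ≡ q m) (countFrom 1 J)
    coord≡q-prefix = All-countFrom 1 J (λ m 1≤m m<1+J → coord≡q 1≤m (≤-pred m<1+J))

    scanC-coord≡scanC-q : scanC (coord qs e0) 0 (range1 J) ≡ scanC q 0 (countFrom 1 J)
    scanC-coord≡scanC-q = trans (cong (scanC (coord qs e0) 0) (range1≡countFrom1 J)) (scanC-cong 0 coord≡q-prefix)

    distVec≢[]⇒one-beyond-1 : ¬ distVec qs e0 ≡ [] → ∃ λ m → q m ≡ 1 × 1 < m
    distVec≢[]⇒one-beyond-1 D≢[] = scanC-nonempty q 0 (countFrom 1 J)
      (λ eq → D≢[] (cong (map (tau (coord qs e0))) (trans scanC-coord≡scanC-q eq)))

    module GreedyPrefix {c : ℕ → ℕ} (greedy : IsDistIdx q c) where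
      open Greedy greedy

      k : ℕ
      k = proj₁ (scanC-from-start J)

      c≤J : ∀ {i} → i ≤ k → c i ≤ J
      c≤J i≤k = ≤-pred (≤-<-trans (c-mono i≤k) (proj₁ (proj₂ (proj₂ (scanC-from-start J)))))

      J<c : ∀ {i} → k < i → J < c i
      J<c k<i = <-≤-trans (proj₂ (proj₂ (proj₂ (scanC-from-start J)))) (c-mono k<i)

      distVec≡ : distVec qs e0 ≡ map (tau q ∘ c) (range1 k)
      distVec≡ = begin
        map (tau (coord qs e0)) (scanC (coord qs e0) 0 (range1 J))
          ≡⟨ cong (map (tau (coord qs e0))) (trans scanC-coord≡scanC-q (proj₁ (proj₂ (scanC-from-start J)))) ⟩
        map (tau (coord qs e0)) (map c (countFrom 1 k))
          ≡⟨ map-∘ (countFrom 1 k) ⟨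
        map (tau (coord qs e0) ∘ c) (countFrom 1 k)
          ≡⟨ map-cong-local (All-countFrom 1 k (λ i _ i<1+k →
               tau-cong (c i) (λ m 1≤m m≤ci → coord≡q 1≤m (≤-trans m≤ci (c≤J (≤-pred i<1+k)))))) ⟩
        map (tau q ∘ c) (countFrom 1 k)
          ≡⟨ cong (map (tau q ∘ c)) (range1≡countFrom1 k) ⟨
        map (tau q ∘ c) (range1 k)
          ∎
        where open ≡-Reasoning

proposition69p1 : (p J : ℕ) (qs : Vec ℕ J) (e0 : ℕ) →
    0 < p →
    InMpPlus p J qs e0 →
    ¬ (distVec qs e0 ≡ []) →
    Σ (ℕ → ℕ) (λ c →
      IsDistIdx (qInf p qs e0) c ×
      Σ ℕ (λ N →
        (∀ i → N < i → (delta J qs e0 ℤ.+ + 1) ℤ.< tau (qInf p qs e0) (c i)) ×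
        (distVec qs e0 ≡
          map (λ i → tau (qInf p qs e0) (c i))
            (range1 (countLe (λ i → tau (qInf p qs e0) (c i)) (delta J qs e0 ℤ.+ + 1) N)))))
proposition69p1 p J qs e0 1≤p ((1≤J , _ , qs-pos) , t , _ , 1≤t , t≤J , ρ-pos , ρ-big) D≢[] =
  c , greedy , k , beyond , trans distVec≡ (cong (map (tau q ∘ c) ∘ range1) (sym γ≡k))
  where
  open ShiftDynamics p J qs e0
  open WellFormed 1≤J qs-pos

  c-greedy : Σ (ℕ → ℕ) (IsDistIdx q)
  c-greedy = let m₀ , q≡1 , 1<m₀ = distVec≢[]⇒one-beyond-1 D≢[] in distIdx-exists q (ones-unbounded 1<m₀ q≡1)

  c : ℕ → ℕ
  c = proj₁ c-greedy

  greedy : IsDistIdx q c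
  greedy = proj₂ c-greedy

  open GreedyPrefix greedy

  γ≡k : countLe (tau q ∘ c) α k ≡ k
  γ≡k = countLe-all (tau q ∘ c) α k (λ i _ i≤k → tau≤α (c i) (c≤J i≤k))

  beyond : ∀ i → k < i → α ℤ.< tau q (c i)
  beyond (suc i) k<1+i = α<tau 1≤p (q₁≥2 1≤p t 1≤t t≤J ρ-pos ρ-big) (J<c k<1+i) (proj₁ (proj₂ (proj₂ greedy i)))
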